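{- Suppose the following statement (A) holds: for all integers $n\ge r\ge 3$ and $k\ge\binom{r}{2}$, and every $k$-weighted graph $(G_0,f)$ with $G_0\cong K_n$ on vertex set $[n]$ such that $G_0$ contains no copy of $K_r$ having weight sequence bound $(1,2,\dots,\binom{r}{2})$, setting $k_2=\left\lceil\frac{(\binom{r}{2}-1)\binom{n}{2}}{t_{r-1}(n)}\right\rceil$ and $k_1=k_2-1$, we have: (i) if $k=k_1$ then $f(G_0)\le(\binom{r}{2}-1)\binom{n}{2}$; and (ii) if $k=k_2$ then $f(G_0)\le k\cdot t_{r-1}(n)$. Then the following statement (B) holds: for all integers $n\ge r-1\ge 2$ and $k\ge\binom{r}{2}$, $$\mathrm{ex}_k(n, K_r)\le\max\left\{\left(\binom{r}{2}-1\right)\binom{n}{2},\ k\cdot t_{r-1}(n)\right\}.$$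
   Context: $K_r$ is the complete graph on $r$ vertices; $t_{r-1}(n)$ is the number of edges of the Turán graph $T_{r-1}(n)$ (complete $(r-1)$-partite graph on $n$ vertices with part sizes differing by at most one). For an integer $\ell$ and a graph $H$, an $\ell$-weighting of $H$ is a map $g:E(H)\to\{0,1,\dots,\ell\}$, and $(H,g)$ is an $\ell$-weighted graph; for a subgraph $H'$, $g(H')=\sum_{e\in E(H')}g(e)$. The weight sequence of a subgraph $H'$ with $m$ edges is the list $(a_1,\dots,a_m)$ of the weights of its edges arranged in nondecreasing order. A nondecreasing sequence $(b_1,\dots,b_m)$ is a weight sequence bound of $H'$ if $a_i\ge b_i$ for every $i\in[m]$, where $(a_1,\dots,a_m)$ is the weight sequence of $H'$. A multiset $\mathcal{G}_n^k=\{G_1,\dots,G_k\}$ of graphs on $[n]$ is rainbow $K_r$-free if there is no copy of $K_r$ in $K_n$ with edges $e_1,\dots,e_{\binom r2}$ and distinct indices $i_1,\dots,i_{\binom r2}\in[k]$ with $e_j\in G_{i_j}$ for all $j$. $\mathrm{ex}_k(n,K_r)$ is the maximum of $\sum_{i=1}^k|E(G_i)|$ over all rainbow $K_r$-free multisets of $k$ graphs on $[n]$. -}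

module Defs where

open import Data.Nat using (ℕ; zero; suc; _+_; _*_; _∸_; _≤_; _<_; _/_; _%_; _≟_)
open import Data.Nat.Properties using (≤-decTotalOrder)
open import Data.Bool using (Bool; true; false; if_then_else_)
open import Data.Fin using (Fin; toℕ) renaming (_<_ to _<ᶠ_; _<?_ to _<ᶠ?_)
open import Data.List using (List; []; _∷_; map; filter; length; concatMap; allFin; applyUpTo)
open import Data.Nat.ListAction using (sum)
open import Data.List.Relation.Binary.Pointwise using (Pointwise)
open import Data.Product using (_×_; _,_; proj₁; proj₂; Σ; ∃)
open import Relation.Nullary using (¬_; does)
open import Relation.Binary.PropositionalEquality using (_≡_)
open import Function.Definitions using (Injective)
open import Data.List.Sort ≤-decTotalOrder using (sort)

-- A graph on vertex set [n] = Fin n is a Bool-valued function; only the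
-- entries (i , j) with i < j are used (the value on the unordered pair {i,j}).
-- An ℓ-weighting of K_n is likewise an ℕ-valued function read on pairs i < j.

at : ∀ {n} {A : Set} → (Fin n → Fin n → A) → Fin n → Fin n → A
at g i j = if does (i <ᶠ? j) then g i j else g j i

pairs : (n : ℕ) → List (Fin n × Fin n)
pairs n = filter (λ p → proj₁ p <ᶠ? proj₂ p)
                 (concatMap (λ i → map (i ,_) (allFin n)) (allFin n))

numEdges : ∀ {n} → (Fin n → Fin n → Bool) → ℕ
numEdges {n} G = sum (map (λ p → if G (proj₁ p) (proj₂ p) then 1 else 0) (pairs n))

totalWeight : ∀ {n} → (Fin n → Fin n → ℕ) → ℕ
totalWeight {n} f = sum (map (λ p → f (proj₁ p) (proj₂ p)) (pairs n))

IsWeighting : ∀ {n} → ℕ → (Fin n → Fin n → ℕ) → Set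
IsWeighting {n} ℓ f = ∀ (i j : Fin n) → i <ᶠ j → f i j ≤ ℓ

-- Turán graph T_s(n): vertices i , j adjacent iff i mod s ≠ j mod s
-- (s residue classes, sizes differ by at most one); t_s(n) its edge count.
-- (s = 0 is a junk case, never used.)
turánGraph : (s n : ℕ) → Fin n → Fin n → Bool
turánGraph zero    n i j = false
turánGraph (suc s) n i j = if does (toℕ i % suc s ≟ toℕ j % suc s) then false else true

turán : ℕ → ℕ → ℕ
turán s n = numEdges (turánGraph s n)

⌈_/_⌉ : ℕ → ℕ → ℕ
⌈ a / zero ⌉  = 0
⌈ a / suc b ⌉ = (a + b) / suc b

weightSeq : ∀ {n r} → (Fin n → Fin n → ℕ) → (Fin r → Fin n) → List ℕ
weightSeq {n} {r} f φ = sort (map (λ p → at f (φ (proj₁ p)) (φ (proj₂ p))) (pairs r))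

IsWeightSeqBound : List ℕ → List ℕ → Set
IsWeightSeqBound bs as = Pointwise (λ a b → b ≤ a) as bs

oneTo : ℕ → List ℕ
oneTo m = applyUpTo suc m

HasBoundedKr : (n r : ℕ) → (Fin n → Fin n → ℕ) → Set
HasBoundedKr n r f =
  Σ (Fin r → Fin n) λ φ → Injective _≡_ _≡_ φ ×
    IsWeightSeqBound (oneTo (length (pairs r))) (weightSeq f φ)

HasRainbowKr : (n r k : ℕ) → (Fin k → Fin n → Fin n → Bool) → Set
HasRainbowKr n r k Gs =
  Σ (Fin r → Fin n) λ φ → Injective _≡_ _≡_ φ ×
  Σ (Fin r → Fin r → Fin k) λ c →
    (∀ a b a' b' → a <ᶠ b → a' <ᶠ b' → c a b ≡ c a' b' → (a ≡ a') × (b ≡ b')) ×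
    (∀ a b → a <ᶠ b → at (Gs (c a b)) (φ a) (φ b) ≡ true)

RainbowKrFree : (n r k : ℕ) → (Fin k → Fin n → Fin n → Bool) → Set
RainbowKrFree n r k Gs = ¬ HasRainbowKr n r k Gs

totalEdges : ∀ {n k} → (Fin k → Fin n → Fin n → Bool) → ℕ
totalEdges {n} {k} Gs = sum (map (λ i → numEdges (Gs i)) (allFin k))

{-# OPTIONS --safe #-}
module Submission where

-- Weight each edge of K_n by the number of graphs of the family containing it. If a copy of K_r
-- has sorted weights dominating (1, 2, …, C(r,2)), list its edges by decreasing weight: the i-th
-- edge from the end lies in at least i graphs, so distinct graphs can be chosen greedily and the
-- copy is rainbow. Hence a rainbow-K_r-free family of k graphs is a k-weighting as in (A) with the
-- same total. For k < k₂ it is also a k₁-weighting and (A)(i) applies; for k = k₂ use (A)(ii);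
-- for k > k₂ delete a graph with fewest edges and induct. If n = r − 1, the Turán graph is K_n.

open import Defs
open import Data.Nat.Properties
open import Algebra.Properties.CommutativeMonoid.Sum +-0-commutativeMonoid
  using (sum-syntax; sum-remove; sum-cong-≗; sum-replicate-zero; ∑-distrib-+)
open import Data.Bool using (Bool; true; false; if_then_else_; not; _∧_)
open import Data.Empty using (⊥-elim)
open import Data.Fin as Fin using (Fin; zero; suc; toℕ; fromℕ<; punchIn)
  renaming (_<_ to _<ᶠ_; _<?_ to _<ᶠ?_)
open import Data.Fin.Properties using (toℕ<n; toℕ-fromℕ<; punchInᵢ≢i; punchIn-injective)
open import Data.List using (List; []; _∷_; _++_; map; filter; length; concatMap; allFin; tabulate;
  applyDownFrom; reverse)
open import Data.List.Extrema.Nat using (argmin; f[argmin]≤f[xs])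
open import Data.List.Membership.Propositional using (_∈_; _∉_)
open import Data.List.Membership.Propositional.Properties
  using (∈-map⁺; ∈-filter⁺; ∈-filter⁻; ∈-concatMap⁺; ∈-allFin)
open import Data.List.Properties
  using (map-++; map-tabulate; map-id; map-∘; map-cong; length-map; length-applyDownFrom;
         reverse-applyUpTo)
open import Data.List.Relation.Binary.Permutation.Propositional using (_↭_; ↭-sym; ↭-trans)
open import Data.List.Relation.Binary.Permutation.Propositional.Properties
  using (↭-map-inv; ↭-reverse; ∈-resp-↭)
open import Data.List.Relation.Binary.Pointwise using (Pointwise; []; _∷_; map⁻; reverse⁺)
  renaming (map to pointwise-map)
open import Data.List.Relation.Binary.Pointwise.Properties using (Pointwise-length)
import Data.List.Relation.Unary.All as All
open import Data.List.Relation.Unary.Any as Any using (here; there; tail)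
open import Data.List.Sort ≤-decTotalOrder using (sort; sort-↭)
open import Data.Nat using (ℕ; zero; suc; _+_; _*_; _∸_; _/_; _%_; _⊔_; pred; _≟_; _≤_; _<_; z≤n; s≤s; z<s;
  _≤′_; ≤′-refl; ≤′-step; NonZero; >-nonZero; >-nonZero⁻¹)
open import Data.Nat.Combinatorics using (_C_; nC1≡n; nCk+nC[k+1]≡[n+1]C[k+1])
open import Data.Nat.DivMod using (m<n⇒m%n≡m; n%n≡0; m*n/n≡m; /-monoˡ-≤)
open import Data.Nat.ListAction using (sum)
open import Data.Nat.ListAction.Properties using (sum-++)
open import Data.Product using (_×_; _,_; proj₁; proj₂; Σ; ∃-syntax; map₂)
open import Data.Product.Properties using (≡-dec)
open import Data.Sum using (inj₁; inj₂)
open import Data.Vec.Functional using (removeAt)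
open import Function using (_∘_; id)
open import Relation.Binary.Definitions using (DecidableEquality)
open import Relation.Binary.PropositionalEquality
open import Relation.Nullary using (¬_; Dec; does; yes; no)
open import Relation.Nullary.Decidable using (dec-true; dec-false)

indicator : Bool → ℕ
indicator b = if b then 1 else 0

indicator≤1 : ∀ b → indicator b ≤ 1
indicator≤1 true  = ≤-refl
indicator≤1 false = z≤n

indicator-mono : ∀ {a b} → (a ≡ true → b ≡ true) → indicator a ≤ indicator b
indicator-mono {false} _   = z≤n
indicator-mono {true}  a⇒b rewrite a⇒b refl = ≤-refl

module _ {A : Set} where

  sum-map-mono : ∀ {f g : A → ℕ} xs → (∀ {x} → x ∈ xs → f x ≤ g x) →
                 sum (map f xs) ≤ sum (map g xs)
  sum-map-mono []       f≤g = z≤n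
  sum-map-mono (x ∷ xs) f≤g = +-mono-≤ (f≤g (here refl)) (sum-map-mono xs (f≤g ∘ there))

  sum-map-mono-< : ∀ {f g : A → ℕ} {x} xs → (∀ {y} → y ∈ xs → f y ≤ g y) → x ∈ xs → f x < g x →
                   sum (map f xs) < sum (map g xs)
  sum-map-mono-< (y ∷ xs) f≤g (here refl) fx<gx = +-mono-<-≤ fx<gx (sum-map-mono xs (f≤g ∘ there))
  sum-map-mono-< (y ∷ xs) f≤g (there x∈) fx<gx =
    +-mono-≤-< (f≤g (here refl)) (sum-map-mono-< xs (f≤g ∘ there) x∈ fx<gx)

  sum-map-filter : ∀ {P : A → Set} (P? : ∀ x → Dec (P x)) (g : A → ℕ) xs →
                   sum (map g (filter P? xs)) ≡ sum (map (λ x → if does (P? x) then g x else 0) xs)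
  sum-map-filter P? g []       = refl
  sum-map-filter P? g (x ∷ xs) with does (P? x)
  ... | true  = cong (g x +_) (sum-map-filter P? g xs)
  ... | false = sum-map-filter P? g xs

  sum-map-concatMap : ∀ {B : Set} (g : B → ℕ) (f : A → List B) xs →
                      sum (map g (concatMap f xs)) ≡ sum (map (λ x → sum (map g (f x))) xs)
  sum-map-concatMap g f []       = refl
  sum-map-concatMap g f (x ∷ xs) = begin
    sum (map g (f x ++ concatMap f xs))
      ≡⟨ cong sum (map-++ g (f x) (concatMap f xs)) ⟩
    sum (map g (f x) ++ map g (concatMap f xs))
      ≡⟨ sum-++ (map g (f x)) _ ⟩
    sum (map g (f x)) + sum (map g (concatMap f xs))
      ≡⟨ cong (sum (map g (f x)) +_) (sum-map-concatMap g f xs) ⟩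
    sum (map (λ x → sum (map g (f x))) (x ∷ xs)) ∎
    where open ≡-Reasoning

  sum-map-∑ : ∀ {k} (h : Fin k → A → ℕ) xs →
              sum (map (λ x → ∑[ i < k ] h i x) xs) ≡ ∑[ i < k ] sum (map (h i) xs)
  sum-map-∑ {k} h []       = sym (sum-replicate-zero k)
  sum-map-∑     h (x ∷ xs) =
    trans (cong (_ +_) (sum-map-∑ h xs))
          (sym (∑-distrib-+ (λ i → h i x) (λ i → sum (map (h i) xs))))

sum-tabulate : ∀ {k} (g : Fin k → ℕ) → sum (tabulate g) ≡ ∑[ i < k ] g i
sum-tabulate {zero}  g = refl
sum-tabulate {suc k} g = cong (g zero +_) (sum-tabulate (g ∘ suc))

sum-map-allFin : ∀ {k} (g : Fin k → ℕ) → sum (map g (allFin k)) ≡ ∑[ i < k ] g i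
sum-map-allFin g = trans (cong sum (map-tabulate id g)) (sum-tabulate g)

∑-≤-* : ∀ {k t} (g : Fin k → ℕ) → (∀ i → g i ≤ t) → ∑[ i < k ] g i ≤ k * t
∑-≤-* {zero}  g g≤t = z≤n
∑-≤-* {suc k} g g≤t = +-mono-≤ (g≤t zero) (∑-≤-* (g ∘ suc) (g≤t ∘ suc))

*-≤-∑ : ∀ {k t} (g : Fin k → ℕ) → (∀ i → t ≤ g i) → k * t ≤ ∑[ i < k ] g i
*-≤-∑ {zero}  g t≤g = z≤n
*-≤-∑ {suc k} g t≤g = +-mono-≤ (t≤g zero) (*-≤-∑ (g ∘ suc) (t≤g ∘ suc))

-- Removing a smallest term: it is at most t because the other m terms sum to at most m * t.
∑-≤-*-removeAt : ∀ {m t} .{{_ : NonZero m}} (g : Fin (suc m) → ℕ) →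
                 (∀ j → ∑[ i < m ] removeAt g j i ≤ m * t) → ∑[ i < suc m ] g i ≤ suc m * t
∑-≤-*-removeAt {m} {t} g bound = begin
  ∑[ i < suc m ] g i               ≡⟨ sum-remove {i = j} g ⟩
  g j + ∑[ i < m ] removeAt g j i  ≤⟨ +-mono-≤ gj≤t (bound j) ⟩
  t + m * t                        ∎
  where
  open ≤-Reasoning
  j : Fin (suc m)
  j = argmin g zero (allFin (suc m))
  gj≤t : g j ≤ t
  gj≤t = *-cancelˡ-≤ m (≤-trans (*-≤-∑ (removeAt g j) (λ i →
           All.lookup (f[argmin]≤f[xs] {f = g} zero (allFin (suc m))) (∈-allFin (punchIn j i))))
         (bound j))

∑-indicator-pos : ∀ {k} (S : Fin k → Bool) → 0 < ∑[ i < k ] indicator (S i) → ∃[ i ] S i ≡ true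
∑-indicator-pos {suc k} S pos with S zero in S0
... | true  = zero , S0
... | false with ∑-indicator-pos (S ∘ suc) pos
...   | i , Si = suc i , Si

∑-indicator-≤-remove : ∀ {k} (S : Fin k → Bool) u →
  ∑[ i < k ] indicator (S i) ≤ suc (∑[ i < k ] indicator (not (does (i Fin.≟ u)) ∧ S i))
∑-indicator-≤-remove {suc k} S u = begin
  ∑[ i < suc k ] indicator (S i)                       ≡⟨ sum-remove {i = u} (indicator ∘ S) ⟩
  indicator (S u) + ∑[ j < k ] indicator (S (punchIn u j))
    ≤⟨ +-monoˡ-≤ _ (indicator≤1 (S u)) ⟩
  suc (∑[ j < k ] indicator (S (punchIn u j)))         ≡⟨ cong suc (sum-cong-≗ S′≗S) ⟨
  suc (∑[ j < k ] indicator (S′ (punchIn u j)))        ≤⟨ s≤s (m≤n+m _ (indicator (S′ u))) ⟩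
  suc (indicator (S′ u) + ∑[ j < k ] indicator (S′ (punchIn u j)))
    ≡⟨ cong suc (sum-remove {i = u} (indicator ∘ S′)) ⟨
  suc (∑[ i < suc k ] indicator (S′ i))                ∎
  where
  open ≤-Reasoning
  S′ : Fin (suc k) → Bool
  S′ i = not (does (i Fin.≟ u)) ∧ S i
  S′≗S : ∀ j → indicator (S′ (punchIn u j)) ≡ indicator (S (punchIn u j))
  S′≗S j rewrite dec-false (punchIn u j Fin.≟ u) (punchInᵢ≢i u j) = refl

pigeonhole-∉ : ∀ {k} (S : Fin k → Bool) (used : List (Fin k)) →
               length used < ∑[ i < k ] indicator (S i) → ∃[ i ] S i ≡ true × i ∉ used
pigeonhole-∉ S []         pos = map₂ (_, λ ()) (∑-indicator-pos S pos)
pigeonhole-∉ S (u ∷ used) len<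
  with pigeonhole-∉ (λ i → not (does (i Fin.≟ u)) ∧ S i) used
         (≤-pred (≤-trans len< (∑-indicator-≤-remove S u)))
... | i , S′i , i∉used with i Fin.≟ u
...   | yes _  with () ← S′i
...   | no i≢u = i , S′i , λ { (here i≡u) → i≢u i≡u ; (there i∈) → i∉used i∈ }

module _ {X : Set} (_≟ˣ_ : DecidableEquality X) {k} (S : X → Fin k → Bool) (default : Fin k) where

  InjectiveChoice : List X → Set
  InjectiveChoice xs = Σ (X → Fin k) λ c →
    (∀ {x} → x ∈ xs → S x (c x) ≡ true) × (∀ {x y} → x ∈ xs → y ∈ xs → c x ≡ c y → x ≡ y)

  -- The head has more admissible colours than the tail has members, so one is left for it.
  injectiveChoice : ∀ {xs m} →
    Pointwise (λ x b → b ≤ ∑[ i < k ] indicator (S x i)) xs (applyDownFrom suc m) →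
    InjectiveChoice xs
  injectiveChoice {[]}     {zero}  []         = (λ _ → default) , (λ ()) , λ ()
  injectiveChoice {x ∷ xs} {suc m} (m<Sx ∷ bounds) with injectiveChoice bounds
  ... | c , c∈S , c-inj with pigeonhole-∉ (S x) (map c xs) (≤-trans (s≤s (≤-reflexive len)) m<Sx)
    where
    len : length (map c xs) ≡ m
    len = trans (length-map c xs)
            (trans (Pointwise-length bounds) (length-applyDownFrom suc m))
  ... | a , Sxa , a∉ = c′ , c′∈S , c′-inj
    where
    c′ : X → Fin k
    c′ y = if does (y ≟ˣ x) then a else c y
    c′∈S : ∀ {y} → y ∈ x ∷ xs → S y (c′ y) ≡ true
    c′∈S {y} y∈ with y ≟ˣ x
    ... | yes refl = Sxa
    ... | no y≢x   = c∈S (tail y≢x y∈)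
    c′-inj : ∀ {y z} → y ∈ x ∷ xs → z ∈ x ∷ xs → c′ y ≡ c′ z → y ≡ z
    c′-inj {y} {z} y∈ z∈ eq with y ≟ˣ x | z ≟ˣ x
    ... | yes refl | yes refl = refl
    ... | yes refl | no z≢x   = ⊥-elim (a∉ (subst (_∈ map c xs) (sym eq) (∈-map⁺ c (tail z≢x z∈))))
    ... | no y≢x   | yes refl = ⊥-elim (a∉ (subst (_∈ map c xs) eq (∈-map⁺ c (tail y≢x y∈))))
    ... | no y≢x   | no z≢x   = c-inj (tail y≢x y∈) (tail z≢x z∈) eq

weightSeqBound⇒ordering : ∀ {A : Set} (w : A → ℕ) xs m →
  IsWeightSeqBound (oneTo m) (sort (map w xs)) →
  ∃[ ys ] xs ↭ ys × Pointwise (λ y b → b ≤ w y) ys (applyDownFrom suc m)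
weightSeqBound⇒ordering w xs m bound with ↭-map-inv w (↭-sym (sort-↭ (map w xs)))
... | zs , sorted≡ , xs↭zs =
  reverse zs , ↭-trans xs↭zs (↭-sym (↭-reverse zs)) ,
  subst (Pointwise _ (reverse zs)) (reverse-applyUpTo suc m)
    (reverse⁺ (map⁻ w id (subst₂ (Pointwise _) sorted≡ (sym (map-id (oneTo m))) bound)))

∈-pairs : ∀ {n} {i j : Fin n} → i <ᶠ j → (i , j) ∈ pairs n
∈-pairs {n} {i} {j} i<j = ∈-filter⁺ (λ p → proj₁ p <ᶠ? proj₂ p)
  (∈-concatMap⁺ (λ i → map (i ,_) (allFin n))
    (Any.map (λ { refl → ∈-map⁺ (i ,_) (∈-allFin j) }) (∈-allFin i)))
  i<j

pairs-< : ∀ {n} {p : Fin n × Fin n} → p ∈ pairs n → proj₁ p <ᶠ proj₂ p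
pairs-< {n} = proj₂ ∘ ∈-filter⁻ (λ p → proj₁ p <ᶠ? proj₂ p)
  {xs = concatMap (λ i → map (i ,_) (allFin n)) (allFin n)}

sum-map-pairs : ∀ {n} (g : Fin n × Fin n → ℕ) →
  sum (map g (pairs n)) ≡ ∑[ i < n ] ∑[ j < n ] (if does (i <ᶠ? j) then g (i , j) else 0)
sum-map-pairs {n} g = begin
  sum (map g (pairs n))
    ≡⟨ sum-map-filter (λ p → proj₁ p <ᶠ? proj₂ p) g (concatMap row (allFin n)) ⟩
  sum (map h (concatMap row (allFin n)))
    ≡⟨ sum-map-concatMap h row (allFin n) ⟩
  sum (map (λ i → sum (map h (row i))) (allFin n))
    ≡⟨ cong sum (map-cong (λ i → trans (cong sum (sym (map-∘ (allFin n))))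
                                       (sum-map-allFin (λ j → h (i , j))))
                          (allFin n)) ⟩
  sum (map (λ i → ∑[ j < n ] h (i , j)) (allFin n))
    ≡⟨ sum-map-allFin (λ i → ∑[ j < n ] h (i , j)) ⟩
  ∑[ i < n ] ∑[ j < n ] h (i , j) ∎
  where
  open ≡-Reasoning
  h : Fin n × Fin n → ℕ
  h p = if does (proj₁ p <ᶠ? proj₂ p) then g p else 0
  row : Fin n → List (Fin n × Fin n)
  row i = map (i ,_) (allFin n)

∑-1 : ∀ n → ∑[ i < n ] 1 ≡ n
∑-1 zero    = refl
∑-1 (suc n) = cong suc (∑-1 n)

∑∑-indicator-< : ∀ n → ∑[ i < n ] ∑[ j < n ] indicator (does (i <ᶠ? j)) ≡ n C 2
∑∑-indicator-< zero    = refl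
∑∑-indicator-< (suc n) = begin
  ∑[ j < n ] 1 + ∑[ i < n ] ∑[ j < n ] indicator (does (i <ᶠ? j))
    ≡⟨ cong₂ _+_ (∑-1 n) (∑∑-indicator-< n) ⟩
  n + n C 2      ≡⟨ cong (_+ n C 2) (nC1≡n n) ⟨
  n C 1 + n C 2  ≡⟨ nCk+nC[k+1]≡[n+1]C[k+1] n 1 ⟩
  suc n C 2      ∎
  where open ≡-Reasoning

numEdges-complete : ∀ n → numEdges {n} (λ _ _ → true) ≡ n C 2
numEdges-complete n = trans (sum-map-pairs {n} (λ _ → 1)) (∑∑-indicator-< n)

module _ {n} {G H : Fin n → Fin n → Bool}
         (G⊆H : ∀ {i j} → i <ᶠ j → G i j ≡ true → H i j ≡ true) where

  numEdges-mono : numEdges G ≤ numEdges H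
  numEdges-mono = sum-map-mono (pairs n) (λ p∈ → indicator-mono (G⊆H (pairs-< p∈)))

  numEdges-mono-< : ∀ {i j} → i <ᶠ j → G i j ≡ false → H i j ≡ true → numEdges G < numEdges H
  numEdges-mono-< i<j Gij Hij =
    sum-map-mono-< (pairs n) (λ p∈ → indicator-mono (G⊆H (pairs-< p∈))) (∈-pairs i<j)
      (subst₂ (λ a b → indicator a < indicator b) (sym Gij) (sym Hij) ≤-refl)

turánGraph-self : ∀ {s} {i j : Fin (suc s)} → i <ᶠ j → turánGraph (suc s) (suc s) i j ≡ true
turánGraph-self {s} {i} {j} i<j
  rewrite m<n⇒m%n≡m (toℕ<n i) | m<n⇒m%n≡m (toℕ<n j) | dec-false (toℕ i ≟ toℕ j) (<⇒≢ i<j) = refl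

numEdges≤turán-self : ∀ {s} (G : Fin (suc s) → Fin (suc s) → Bool) →
                      numEdges G ≤ turán (suc s) (suc s)
numEdges≤turán-self {s} G =
  numEdges-mono {H = turánGraph (suc s) (suc s)} (λ i<j _ → turánGraph-self i<j)

-- Vertices 0 and s + 1 lie in the same part, so T_{s+1}(n) misses an edge.
turán<nC2 : ∀ {s n} → suc s < n → turán (suc s) n < n C 2
turán<nC2 {s} {n} s<n = subst (turán (suc s) n <_) (numEdges-complete n)
  (numEdges-mono-< {H = λ _ _ → true} (λ _ _ → refl) first<last sameClass refl)
  where
  0<n : 0 < n
  0<n = <-trans z<s s<n
  first<last : fromℕ< 0<n <ᶠ fromℕ< s<n
  first<last rewrite toℕ-fromℕ< 0<n | toℕ-fromℕ< s<n = z<s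
  sameClass : turánGraph (suc s) n (fromℕ< 0<n) (fromℕ< s<n) ≡ false
  sameClass = cong (if_then false else true) (dec-true (_ ≟ _) (begin
    toℕ (fromℕ< 0<n) % suc s  ≡⟨ cong (_% suc s) (toℕ-fromℕ< 0<n) ⟩
    0                         ≡⟨ n%n≡0 (suc s) ⟨
    suc s % suc s             ≡⟨ cong (_% suc s) (toℕ-fromℕ< s<n) ⟨
    toℕ (fromℕ< s<n) % suc s  ∎))
    where open ≡-Reasoning

turán-pos : ∀ {s n} → 1 < n → 0 < turán (suc (suc s)) n
turán-pos {n = suc zero} (s≤s ())
turán-pos {s} {suc (suc n)} _ =
  ≤-<-trans z≤n (numEdges-mono-< {G = λ _ _ → false} {H = turánGraph (suc (suc s)) (suc (suc n))}
                   (λ _ ()) {j = suc zero} z<s refl refl)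

module _ {n k : ℕ} (Gs : Fin k → Fin n → Fin n → Bool) where

  multiplicity : Fin n → Fin n → ℕ
  multiplicity x y = ∑[ i < k ] indicator (Gs i x y)

  at-multiplicity : ∀ x y → at multiplicity x y ≡ ∑[ i < k ] indicator (at (Gs i) x y)
  at-multiplicity x y with does (x <ᶠ? y)
  ... | true  = refl
  ... | false = refl

  multiplicity-isWeighting : IsWeighting k multiplicity
  multiplicity-isWeighting x y _ =
    ≤-trans (∑-≤-* _ (λ i → indicator≤1 (Gs i x y))) (≤-reflexive (*-identityʳ k))

  totalEdges≡∑ : totalEdges Gs ≡ ∑[ i < k ] numEdges (Gs i)
  totalEdges≡∑ = sum-map-allFin (numEdges ∘ Gs)

  totalWeight-multiplicity : totalWeight multiplicity ≡ totalEdges Gs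
  totalWeight-multiplicity =
    trans (sum-map-∑ (λ i p → indicator (Gs i (proj₁ p) (proj₂ p))) (pairs n)) (sym totalEdges≡∑)

  hasBoundedKr⇒hasRainbowKr : ∀ {r} .{{_ : NonZero k}} →
                              HasBoundedKr n r multiplicity → HasRainbowKr n r k Gs
  hasBoundedKr⇒hasRainbowKr {r} (φ , φ-inj , bound) = φ , φ-inj , colour , colour-inj , colour-edge
    where
    w : Fin r × Fin r → ℕ
    w p = at multiplicity (φ (proj₁ p)) (φ (proj₂ p))
    S : Fin r × Fin r → Fin k → Bool
    S p i = at (Gs i) (φ (proj₁ p)) (φ (proj₂ p))
    ordering : ∃[ ys ] pairs r ↭ ys ×
                 Pointwise (λ y b → b ≤ w y) ys (applyDownFrom suc (length (pairs r)))
    ordering = weightSeqBound⇒ordering w (pairs r) (length (pairs r)) bound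
    ys : List (Fin r × Fin r)
    ys = proj₁ ordering
    default : Fin k
    default = fromℕ< (>-nonZero⁻¹ k)
    choice : InjectiveChoice (≡-dec Fin._≟_ Fin._≟_) S default ys
    choice = injectiveChoice (≡-dec Fin._≟_ Fin._≟_) S default
      (pointwise-map (λ {p} → subst (_ ≤_) (at-multiplicity (φ (proj₁ p)) (φ (proj₂ p))))
        (proj₂ (proj₂ ordering)))
    edge∈ys : ∀ {a b} → a <ᶠ b → (a , b) ∈ ys
    edge∈ys a<b = ∈-resp-↭ (proj₁ (proj₂ ordering)) (∈-pairs a<b)
    colour : Fin r → Fin r → Fin k
    colour a b = proj₁ choice (a , b)
    colour-inj : ∀ a b a′ b′ → a <ᶠ b → a′ <ᶠ b′ →
                 colour a b ≡ colour a′ b′ → a ≡ a′ × b ≡ b′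
    colour-inj a b a′ b′ a<b a′<b′ eq with proj₂ (proj₂ choice) (edge∈ys a<b) (edge∈ys a′<b′) eq
    ... | refl = refl , refl
    colour-edge : ∀ a b → a <ᶠ b → at (Gs (colour a b)) (φ a) (φ b) ≡ true
    colour-edge a b a<b = proj₁ (proj₂ choice) (edge∈ys a<b)

totalEdges≤*turán-self : ∀ {s k} (Gs : Fin k → Fin (suc s) → Fin (suc s) → Bool) →
                         totalEdges Gs ≤ k * turán (suc s) (suc s)
totalEdges≤*turán-self Gs =
  subst (_≤ _) (sym (totalEdges≡∑ Gs)) (∑-≤-* _ (numEdges≤turán-self ∘ Gs))

m*n<o⇒m<⌈o/n⌉ : ∀ {m n o} → 0 < n → m * n < o → m < ⌈ o / n ⌉
m*n<o⇒m<⌈o/n⌉ {m} {suc n} {o} _ mn<o = begin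
  suc m                  ≡⟨ m*n/n≡m (suc m) (suc n) ⟨
  suc m * suc n / suc n  ≤⟨ /-monoˡ-≤ (suc n) (begin
    suc n + m * suc n      ≡⟨ +-suc n (m * suc n) ⟨
    n + suc (m * suc n)    ≤⟨ +-monoʳ-≤ n mn<o ⟩
    n + o                  ≡⟨ +-comm n o ⟩
    o + n                  ∎) ⟩
  (o + n) / suc n        ∎
  where open ≤-Reasoning

n≤[1+n]C2 : ∀ n → n ≤ suc n C 2
n≤[1+n]C2 n = begin
  n              ≤⟨ m≤m+n n (n C 2) ⟩
  n + n C 2      ≡⟨ cong (_+ n C 2) (nC1≡n n) ⟨
  n C 1 + n C 2  ≡⟨ nCk+nC[k+1]≡[n+1]C[k+1] n 1 ⟩
  suc n C 2      ∎
  where open ≤-Reasoning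

2≤rC2 : ∀ {r} → 3 ≤ r → 2 ≤ r C 2
2≤rC2 {suc (suc (suc r))} (s≤s (s≤s (s≤s _))) = ≤-trans (s≤s (s≤s z≤n)) (n≤[1+n]C2 (suc (suc r)))

k₂ : ℕ → ℕ → ℕ
k₂ n r = ⌈ ((r C 2) ∸ 1) * (n C 2) / turán (r ∸ 1) n ⌉

rC2≤k₂ : ∀ {n r} → 3 ≤ r → r ≤ n → r C 2 ≤ k₂ n r
rC2≤k₂ {n} {r} 3≤r@(s≤s (s≤s (s≤s _))) r≤n = begin
  r C 2               ≡⟨ suc-pred (r C 2) {{rC2≢0}} ⟨
  suc (pred (r C 2))  ≤⟨ m*n<o⇒m<⌈o/n⌉ (turán-pos (≤-trans (s≤s (s≤s z≤n)) r≤n))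
                           (*-monoʳ-< (pred (r C 2)) {{rC2∸1≢0}} (turán<nC2 r≤n)) ⟩
  k₂ n r              ∎
  where
  open ≤-Reasoning
  rC2≢0 : NonZero (r C 2)
  rC2≢0 = >-nonZero (≤-trans (s≤s z≤n) (2≤rC2 3≤r))
  rC2∸1≢0 : NonZero (pred (r C 2))
  rC2∸1≢0 = >-nonZero (∸-monoˡ-≤ 1 (2≤rC2 3≤r))

ExBound : (n r k b : ℕ) → Set
ExBound n r k b =
  ∀ (Gs : Fin k → Fin n → Fin n → Bool) → RainbowKrFree n r k Gs → totalEdges Gs ≤ b

rainbowKrFree-removeAt : ∀ {n r k} (Gs : Fin (suc k) → Fin n → Fin n → Bool) j →
  RainbowKrFree n r (suc k) Gs → RainbowKrFree n r k (removeAt Gs j)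
rainbowKrFree-removeAt Gs j free (φ , φ-inj , colour , colour-inj , colour-edge) =
  free (φ , φ-inj , (λ a b → punchIn j (colour a b)) ,
        (λ a b a′ b′ a<b a′<b′ → colour-inj a b a′ b′ a<b a′<b′ ∘ punchIn-injective j _ _) ,
        colour-edge)

exBound-suc : ∀ {n r k t} .{{_ : NonZero k}} →
              ExBound n r k (k * t) → ExBound n r (suc k) (suc k * t)
exBound-suc {k = k} {t} bound Gs free = begin
  totalEdges Gs                 ≡⟨ totalEdges≡∑ Gs ⟩
  ∑[ i < suc k ] numEdges (Gs i) ≤⟨ ∑-≤-*-removeAt (numEdges ∘ Gs) (λ j →
    subst (_≤ k * t) (totalEdges≡∑ (removeAt Gs j))
      (bound (removeAt Gs j) (rainbowKrFree-removeAt Gs j free))) ⟩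
  suc k * t                     ∎
  where open ≤-Reasoning

exBound-mono : ∀ {n r k₀ k t} → 0 < k₀ →
               ExBound n r k₀ (k₀ * t) → k₀ ≤′ k → ExBound n r k (k * t)
exBound-mono k₀>0 bound ≤′-refl = bound
exBound-mono k₀>0 bound (≤′-step k₀≤′k) =
  exBound-suc {{>-nonZero (<-≤-trans k₀>0 (≤′⇒≤ k₀≤′k))}} (exBound-mono k₀>0 bound k₀≤′k)

StatementA : Set
StatementA = ∀ (n r k : ℕ) → 3 ≤ r → r ≤ n → r C 2 ≤ k →
  ∀ (f : Fin n → Fin n → ℕ) → IsWeighting k f → ¬ HasBoundedKr n r f →
    (k ≡ ⌈ ((r C 2) ∸ 1) * (n C 2) / turán (r ∸ 1) n ⌉ ∸ 1 →
       totalWeight f ≤ ((r C 2) ∸ 1) * (n C 2))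
    × (k ≡ ⌈ ((r C 2) ∸ 1) * (n C 2) / turán (r ∸ 1) n ⌉ →
       totalWeight f ≤ k * turán (r ∸ 1) n)

statementA-multiplicity : StatementA → ∀ {n r k k′} → 3 ≤ r → r ≤ n → r C 2 ≤ k → k ≤ k′ →
  ∀ (Gs : Fin k → Fin n → Fin n → Bool) → RainbowKrFree n r k Gs →
    (k′ ≡ pred (k₂ n r) → totalEdges Gs ≤ ((r C 2) ∸ 1) * (n C 2))
    × (k′ ≡ k₂ n r → totalEdges Gs ≤ k′ * turán (r ∸ 1) n)
statementA-multiplicity statementA {n} {r} {k} {k′} 3≤r r≤n rC2≤k k≤k′ Gs free
  rewrite sym (totalWeight-multiplicity Gs) =
  statementA n r k′ 3≤r r≤n (≤-trans rC2≤k k≤k′) (multiplicity Gs)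
    (λ i j i<j → ≤-trans (multiplicity-isWeighting Gs i j i<j) k≤k′)
    (free ∘ hasBoundedKr⇒hasRainbowKr Gs {{k≢0}})
  where
  k≢0 : NonZero k
  k≢0 = >-nonZero (≤-trans (≤-trans (s≤s z≤n) (2≤rC2 3≤r)) rC2≤k)

exBound-below-k₂ : StatementA → ∀ {n r k} → 3 ≤ r → r ≤ n → r C 2 ≤ k → k < k₂ n r →
                   ExBound n r k (((r C 2) ∸ 1) * (n C 2))
exBound-below-k₂ statementA 3≤r r≤n rC2≤k k<k₂ Gs free =
  proj₁ (statementA-multiplicity statementA 3≤r r≤n rC2≤k (<⇒≤pred k<k₂) Gs free) refl

exBound-from-k₂ : StatementA → ∀ {n r k} → 3 ≤ r → r ≤ n → k₂ n r ≤ k →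
                  ExBound n r k (k * turán (r ∸ 1) n)
exBound-from-k₂ statementA {n} {r} 3≤r r≤n k₂≤k = exBound-mono k₂>0 exBound-k₂ (≤⇒≤′ k₂≤k)
  where
  k₂≥rC2 : r C 2 ≤ k₂ n r
  k₂≥rC2 = rC2≤k₂ 3≤r r≤n
  k₂>0 : 0 < k₂ n r
  k₂>0 = ≤-trans (≤-trans (s≤s z≤n) (2≤rC2 3≤r)) k₂≥rC2
  exBound-k₂ : ExBound n r (k₂ n r) (k₂ n r * turán (r ∸ 1) n)
  exBound-k₂ Gs free = proj₂ (statementA-multiplicity statementA 3≤r r≤n k₂≥rC2 ≤-refl Gs free) refl

theorem2p3 :
    (∀ (n r k : ℕ) → 3 ≤ r → r ≤ n → r C 2 ≤ k →
      ∀ (f : Fin n → Fin n → ℕ) → IsWeighting k f → ¬ HasBoundedKr n r f →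
        (k ≡ ⌈ ((r C 2) ∸ 1) * (n C 2) / turán (r ∸ 1) n ⌉ ∸ 1 →
           totalWeight f ≤ ((r C 2) ∸ 1) * (n C 2))
        × (k ≡ ⌈ ((r C 2) ∸ 1) * (n C 2) / turán (r ∸ 1) n ⌉ →
           totalWeight f ≤ k * turán (r ∸ 1) n))
    → ∀ (n r k : ℕ) → 3 ≤ r → r ∸ 1 ≤ n → r C 2 ≤ k →
      ∀ (Gs : Fin k → Fin n → Fin n → Bool) → RainbowKrFree n r k Gs →
        totalEdges Gs ≤ (((r C 2) ∸ 1) * (n C 2)) ⊔ (k * turán (r ∸ 1) n)
theorem2p3 statementA n r k 3≤r@(s≤s (s≤s (s≤s _))) r∸1≤n rC2≤k Gs free
  with m≤n⇒m<n∨m≡n r∸1≤n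
... | inj₂ refl = ≤-trans (totalEdges≤*turán-self Gs) (m≤n⊔m _ _)
... | inj₁ r≤n with k <? k₂ n r
...   | yes k<k₂ = ≤-trans (exBound-below-k₂ statementA 3≤r r≤n rC2≤k k<k₂ Gs free) (m≤m⊔n _ _)
...   | no k≮k₂  = ≤-trans (exBound-from-k₂ statementA 3≤r r≤n (≮⇒≥ k≮k₂) Gs free) (m≤n⊔m _ _)
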